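{- Up to isomorphism, there is a unique set $X \subseteq \mathbb{Z}_3^4$ such that the subgraph of $H(4,3)$ induced by $X$ has maximum degree $1$ and $|X| = 3^3 + 2$.
   Context: $H(4,3)$ is the Hamming graph on $\mathbb{Z}_3^4$ (vertices adjacent iff they differ in exactly one coordinate). Two subsets are isomorphic if some graph automorphism of $H(4,3)$ maps one onto the other. -}

module Defs where

open import Data.Nat using (ℕ; zero; suc; _+_; _≤_; _^_)
open import Data.Nat.Properties using () renaming (_≟_ to _≟ℕ_)
open import Data.Fin using (Fin)
open import Data.Fin.Properties using (_≟_)
open import Data.Vec using (Vec; []; _∷_)
open import Data.List using (List; [_]; concatMap; map; filter; length; allFin)
open import Data.Bool using (Bool; true; false; _∧_; if_then_else_)
open import Data.Product using (Σ; ∃; _×_)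
open import Relation.Nullary using (does)
open import Relation.Binary.PropositionalEquality using (_≡_)
open import Function.Bundles using (_⇔_)

V : Set
V = Vec (Fin 3) 4

allWords : (n : ℕ) → List (Vec (Fin 3) n)
allWords zero = [ [] ]
allWords (suc n) = concatMap (λ a → map (a ∷_) (allWords n)) (allFin 3)

allV : List V
allV = allWords 4

dist : {n : ℕ} → Vec (Fin 3) n → Vec (Fin 3) n → ℕ
dist [] [] = 0
dist (a ∷ u) (b ∷ v) = (if does (a ≟ b) then 0 else 1) + dist u v

Adj : V → V → Set
Adj u v = dist u v ≡ 1

adj? : V → V → Bool
adj? u v = does (dist u v ≟ℕ 1)

SubsetV : Set
SubsetV = V → Bool

card : SubsetV → ℕ
card X = length (filter (λ u → X u ≟B true) allV)
  where
  open import Data.Bool.Properties using () renaming (_≟_ to _≟B_)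

degIn : SubsetV → V → ℕ
degIn X v = length (filter (λ u → (X u ∧ adj? u v) ≟B true) allV)
  where
  open import Data.Bool.Properties using () renaming (_≟_ to _≟B_)

MaxDegOne : SubsetV → Set
MaxDegOne X = (∀ v → X v ≡ true → degIn X v ≤ 1)
            × (∃ λ v → X v ≡ true × degIn X v ≡ 1)

IsAutomorphism : (V → V) → Set
IsAutomorphism f =
  (Σ (V → V) λ g → (∀ v → g (f v) ≡ v) × (∀ v → f (g v) ≡ v))
  × (∀ u v → Adj u v ⇔ Adj (f u) (f v))

Isomorphic : SubsetV → SubsetV → Set
Isomorphic X Y = Σ (V → V) λ f → IsAutomorphism f × (∀ v → Y (f v) ≡ X v)

Good : SubsetV → Set
Good X = MaxDegOne X × card X ≡ 3 ^ 3 + 2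

{-# OPTIONS --safe #-}
module Submission where

-- A set has maximum degree at most 1 exactly when it contains no cherry, i.e. no vertex with two
-- distinct neighbours in the set. Cherry-free sets are classified by induction on the dimension.
-- A cherry-free set in H(n+1,3) with more than 3j points has a slice x₁ = a with more than j
-- points; an automorphism moves that slice to x₁ = 0 and, by the classification in dimension n,
-- turns it into one of finitely many representatives. A branch-and-bound search over the other two
-- slices, pruned by the maximum sizes known in lower dimensions, then matches every completion with
-- a representative in dimension n+1 through an explicit automorphism. With an empty list of
-- representatives the same step shows that cherry-free sets in dimensions 1, 2 and 3 have at most
-- 2, 4 and 10 points. Since 29 > 3·9, a cherry-free 29-set in H(4,3) has a slice with 10 points,
-- which leaves two classes of slices to extend; only one of them extends at all, and all its
-- extensions are equivalent.

open import Data.Bool using (Bool; true; false; T; _∧_; _∨_; if_then_else_)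
open import Data.Bool.Properties as Bool using (T-∧; T-∨; T-≡)
open import Data.Empty using (⊥-elim)
open import Data.Fin using (Fin; suc)
open import Data.Fin.Patterns using (0F; 1F; 2F)
open import Data.Fin.Permutation as Perm using (Permutation′; transpose; _⟨$⟩ʳ_; _⟨$⟩ˡ_; _∘ₚ_)
open import Data.Fin.Properties as Fin using (_≟_)
open import Data.List using (List; []; _∷_; _++_; map; concatMap; filter; length; allFin)
open import Data.List.Properties using (map-++; map-∘)
import Data.List.Relation.Unary.All as All
open All using ([]; _∷_)
open import Data.List.Relation.Unary.Any as Any using (Any; here; satisfied; any?)
open import Data.List.Relation.Unary.Any.Properties using (¬Any[]; singleton⁻)
open import Data.Maybe using (Maybe; just; nothing)
import Data.Maybe.Properties as Maybe
open import Data.Maybe.Relation.Unary.All using (All; just; nothing; drop-just)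
open import Data.Nat using (ℕ; zero; suc; _+_; _⊓_; _^_; _≤_; _<_; _<ᵇ_; z≤n)
open import Data.Nat.ListAction using (sum)
open import Data.Nat.ListAction.Properties using (sum-++)
open import Data.Nat.Properties as ℕ
  using (+-commutativeSemigroup; +-identityʳ; +-mono-≤; ≤-refl; ≤-reflexive; ≤-trans; <-≤-trans; ⊓-glb;
         <ᵇ⇒<; <⇒≱; ≮⇒≥; _<?_)
open import Data.Product using (Σ; ∃; _×_; _,_)
open import Data.Sum using (_⊎_; inj₁; inj₂)
open import Data.Unit using (⊤; tt)
open import Data.Vec using (Vec; []; _∷_)
open import Data.Vec.Properties using (≡-dec)
open import Function using (_∘_; const)
open import Function.Bundles using (Inverse; Equivalence; Injection; _↔_; _⇔_; mk↔ₛ′; mk⇔)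
open import Function.Construct.Composition using (_↔-∘_)
open import Function.Construct.Identity using (↔-id)
open import Function.Properties.Inverse using (↔⇒↣)
open import Relation.Binary.Definitions using (DecidableEquality)
open import Relation.Binary.PropositionalEquality
  using (_≡_; _≢_; refl; sym; trans; cong; cong₂; subst; module ≡-Reasoning)
open import Relation.Nullary using (¬_; Dec; does; yes; no)
open import Relation.Nullary.Decidable
  using (_×-dec_; _⊎-dec_; _→-dec_; ¬?; map′; isYes; toWitness; dec-true; does-⇔)
open import Relation.Unary using (Decidable)
open import Defs

open import Algebra.Properties.CommutativeSemigroup +-commutativeSemigroup using (interchange; x∙yz≈y∙xz)
open ≡-Reasoning

-- Words and sums over all words

Word : ℕ → Set
Word n = Vec (Fin 3) n

_≟ʷ_ : ∀ {n} → DecidableEquality (Word n)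
_≟ʷ_ = ≡-dec _≟_

slice : ∀ {a n} {A : Set a} → (Word (suc n) → A) → Fin 3 → Word n → A
slice h a w = h (a ∷ w)

∀ʷ? : ∀ {n} {P : Word n → Set} → Decidable P → Dec (∀ w → P w)
∀ʷ? {zero}  P? = map′ (λ { p [] → p }) (λ p → p []) (P? [])
∀ʷ? {suc n} P? =
  map′ (λ { p (a ∷ w) → p a w }) (λ p a w → p (a ∷ w)) (Fin.all? λ a → ∀ʷ? λ w → P? (a ∷ w))

∑ : ∀ n → (Word n → ℕ) → ℕ
∑ zero    h = h []
∑ (suc n) h = ∑ n (slice h 0F) + (∑ n (slice h 1F) + ∑ n (slice h 2F))

count : ∀ n → (Word n → Bool) → ℕ
count n Z = ∑ n (λ w → if Z w then 1 else 0)

∑-cong : ∀ n {h k : Word n → ℕ} → (∀ w → h w ≡ k w) → ∑ n h ≡ ∑ n k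
∑-cong zero    h≗k = h≗k []
∑-cong (suc n) h≗k =
  cong₂ _+_ (∑-cong n (h≗k ∘ (0F ∷_)))
            (cong₂ _+_ (∑-cong n (h≗k ∘ (1F ∷_))) (∑-cong n (h≗k ∘ (2F ∷_))))

∑-mono : ∀ n {h k : Word n → ℕ} → (∀ w → h w ≤ k w) → ∑ n h ≤ ∑ n k
∑-mono zero    h≤k = h≤k []
∑-mono (suc n) h≤k =
  +-mono-≤ (∑-mono n (h≤k ∘ (0F ∷_)))
           (+-mono-≤ (∑-mono n (h≤k ∘ (1F ∷_))) (∑-mono n (h≤k ∘ (2F ∷_))))

∑-zero : ∀ n → ∑ n (const 0) ≡ 0
∑-zero zero    = refl
∑-zero (suc n) = cong (λ s → s + (s + s)) (∑-zero n)

∑-+ : ∀ n (h k : Word n → ℕ) → ∑ n (λ w → h w + k w) ≡ ∑ n h + ∑ n k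
∑-+ zero    h k = refl
∑-+ (suc n) h k = begin
  ∑ (suc n) (λ w → h w + k w)
    ≡⟨ cong₂ _+_ (∑-+ n _ _) (cong₂ _+_ (∑-+ n _ _) (∑-+ n _ _)) ⟩
  (H 0F + K 0F) + ((H 1F + K 1F) + (H 2F + K 2F))
    ≡⟨ cong (H 0F + K 0F +_) (interchange (H 1F) (K 1F) (H 2F) (K 2F)) ⟩
  (H 0F + K 0F) + ((H 1F + H 2F) + (K 1F + K 2F))
    ≡⟨ interchange (H 0F) (K 0F) _ _ ⟩
  ∑ (suc n) h + ∑ (suc n) k ∎
  where
  H K : Fin 3 → ℕ
  H a = ∑ n (slice h a)
  K a = ∑ n (slice k a)

∑-swap : ∀ n m (h : Word n → Word m → ℕ) → ∑ n (λ w → ∑ m (h w)) ≡ ∑ m (λ u → ∑ n (λ w → h w u))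
∑-swap zero    m h = refl
∑-swap (suc n) m h = begin
  ∑ n (λ w → ∑ m (h (0F ∷ w))) + (∑ n (λ w → ∑ m (h (1F ∷ w))) + ∑ n (λ w → ∑ m (h (2F ∷ w))))
    ≡⟨ cong₂ _+_ (∑-swap n m _) (cong₂ _+_ (∑-swap n m _) (∑-swap n m _)) ⟩
  H 0F + (H 1F + H 2F)
    ≡⟨ cong (H 0F +_) (sym (∑-+ m _ _)) ⟩
  H 0F + ∑ m (λ u → ∑ n (λ w → h (1F ∷ w) u) + ∑ n (λ w → h (2F ∷ w) u))
    ≡⟨ sym (∑-+ m _ _) ⟩
  ∑ m (λ u → ∑ (suc n) (λ w → h w u)) ∎
  where
  H : Fin 3 → ℕ
  H a = ∑ m (λ u → ∑ n (λ w → h (a ∷ w) u))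

∑-δ : ∀ n (u : Word n) (h : Word n → ℕ) → ∑ n (λ w → if does (w ≟ʷ u) then h w else 0) ≡ h u
∑-δ zero    []       h = refl
∑-δ (suc n) (0F ∷ u) h = begin
  ∑ n _ + (∑ n (const 0) + ∑ n (const 0))
    ≡⟨ cong₂ _+_ (∑-δ n u (slice h 0F)) (cong₂ _+_ (∑-zero n) (∑-zero n)) ⟩
  h (0F ∷ u) + 0
    ≡⟨ +-identityʳ _ ⟩
  h (0F ∷ u) ∎
∑-δ (suc n) (1F ∷ u) h = begin
  ∑ n (const 0) + (∑ n _ + ∑ n (const 0))
    ≡⟨ cong₂ _+_ (∑-zero n) (cong₂ _+_ (∑-δ n u (slice h 1F)) (∑-zero n)) ⟩
  h (1F ∷ u) + 0
    ≡⟨ +-identityʳ _ ⟩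
  h (1F ∷ u) ∎
∑-δ (suc n) (2F ∷ u) h = cong₂ _+_ (∑-zero n) (cong₂ _+_ (∑-zero n) (∑-δ n u (slice h 2F)))

-- Double counting the pairs (w, u) with u = f w.
∑-↔ : ∀ n (f : Word n ↔ Word n) (h : Word n → ℕ) → ∑ n (h ∘ Inverse.to f) ≡ ∑ n h
∑-↔ n f h = begin
  ∑ n (λ w → h (to w))
    ≡⟨ ∑-cong n (λ w → sym (∑-δ n (to w) h)) ⟩
  ∑ n (λ w → ∑ n (λ u → if does (u ≟ʷ to w) then h u else 0))
    ≡⟨ ∑-swap n n _ ⟩
  ∑ n (λ u → ∑ n (λ w → if does (u ≟ʷ to w) then h u else 0))
    ≡⟨ ∑-cong n (λ u → ∑-cong n (λ w → cong (if_then h u else 0) (adjoint u w))) ⟩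
  ∑ n (λ u → ∑ n (λ w → if does (w ≟ʷ from u) then h u else 0))
    ≡⟨ ∑-cong n (λ u → ∑-δ n (from u) (const (h u))) ⟩
  ∑ n h ∎
  where
  open Inverse f using (to; from; strictlyInverseˡ; strictlyInverseʳ)
  adjoint : ∀ u w → does (u ≟ʷ to w) ≡ does (w ≟ʷ from u)
  adjoint u w =
    does-⇔ (mk⇔ (λ { refl → sym (strictlyInverseʳ w) }) (λ { refl → sym (strictlyInverseˡ u) }))
           (u ≟ʷ to w) (w ≟ʷ from u)

∑-pair : ∀ n {u v : Word n} (h : Word n → ℕ) → u ≢ v → h u + h v ≤ ∑ n h
∑-pair n {u} {v} h u≢v = ≤-trans (≤-reflexive split) (∑-mono n disjoint)
  where
  δ : Word n → Word n → ℕ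
  δ u w = if does (w ≟ʷ u) then h w else 0
  split : h u + h v ≡ ∑ n (λ w → δ u w + δ v w)
  split = begin
    h u + h v                 ≡⟨ sym (cong₂ _+_ (∑-δ n u h) (∑-δ n v h)) ⟩
    ∑ n (δ u) + ∑ n (δ v)     ≡⟨ sym (∑-+ n (δ u) (δ v)) ⟩
    ∑ n (λ w → δ u w + δ v w) ∎
  disjoint : ∀ w → δ u w + δ v w ≤ h w
  disjoint w with w ≟ʷ u | w ≟ʷ v
  ... | yes refl | yes refl = ⊥-elim (u≢v refl)
  ... | yes _    | no _     = ≤-reflexive (+-identityʳ (h w))
  ... | no _     | yes _    = ≤-refl
  ... | no _     | no _     = z≤n

sum-map-allWords : ∀ n (h : Word n → ℕ) → sum (map h (allWords n)) ≡ ∑ n h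
sum-map-slices : ∀ n (h : Word (suc n) → ℕ) (as : List (Fin 3)) →
                 sum (map h (concatMap (λ a → map (a ∷_) (allWords n)) as)) ≡ sum (map (∑ n ∘ slice h) as)

sum-map-allWords zero    h = +-identityʳ (h [])
sum-map-allWords (suc n) h =
  trans (sum-map-slices n h (allFin 3)) (cong (λ s → H 0F + (H 1F + s)) (+-identityʳ (H 2F)))
  where
  H : Fin 3 → ℕ
  H a = ∑ n (slice h a)

sum-map-slices n h []       = refl
sum-map-slices n h (a ∷ as) = begin
  sum (map h (map (a ∷_) ws ++ rest))
    ≡⟨ cong sum (map-++ h (map (a ∷_) ws) rest) ⟩
  sum (map h (map (a ∷_) ws) ++ map h rest)
    ≡⟨ sum-++ (map h (map (a ∷_) ws)) (map h rest) ⟩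
  sum (map h (map (a ∷_) ws)) + sum (map h rest)
    ≡⟨ cong₂ _+_ (cong sum (sym (map-∘ ws))) (sum-map-slices n h as) ⟩
  sum (map (slice h a) ws) + _
    ≡⟨ cong (_+ _) (sum-map-allWords n (slice h a)) ⟩
  ∑ n (slice h a) + _ ∎
  where
  ws : List (Word n)
  ws = allWords n
  rest : List (Word (suc n))
  rest = concatMap (λ a → map (a ∷_) ws) as

length-filter≡sum-map : ∀ {A : Set} (Z : A → Bool) xs →
                        length (filter (λ u → Z u Bool.≟ true) xs) ≡ sum (map (λ u → if Z u then 1 else 0) xs)
length-filter≡sum-map Z []       = refl
length-filter≡sum-map Z (x ∷ xs) with Z x
... | true  = cong suc (length-filter≡sum-map Z xs)
... | false = length-filter≡sum-map Z xs

length-filter≡count : ∀ n (Z : Word n → Bool) →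
                      length (filter (λ u → Z u Bool.≟ true) (allWords n)) ≡ count n Z
length-filter≡count n Z = trans (length-filter≡sum-map Z (allWords n)) (sum-map-allWords n _)

count-↔ : ∀ n (f : Word n ↔ Word n) (Z : Word n → Bool) → count n (Z ∘ Inverse.to f) ≡ count n Z
count-↔ n f Z = ∑-↔ n f (λ w → if Z w then 1 else 0)

count-pair : ∀ n {Z : Word n → Bool} {u v} → u ≢ v → T (Z u) → T (Z v) → 2 ≤ count n Z
count-pair n {Z} u≢v Zu Zv =
  ≤-trans (≤-reflexive (sym (cong₂ _+_ (one Zu) (one Zv)))) (∑-pair n (λ w → if Z w then 1 else 0) u≢v)
  where
  one : ∀ {b} → T b → (if b then 1 else 0) ≡ 1
  one {true} _ = refl

-- Cherry-free sets

Isometry : ∀ {m n} → (Word m → Word n) → Set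
Isometry f = ∀ u v → dist (f u) (f v) ≡ dist u v

dist-self : ∀ {n} (u : Word n) → dist u u ≡ 0
dist-self []      = refl
dist-self (a ∷ u) rewrite dec-true (a ≟ a) refl = dist-self u

dist-sym : ∀ {n} (u v : Word n) → dist u v ≡ dist v u
dist-sym []      []      = refl
dist-sym (a ∷ u) (b ∷ v) =
  cong₂ _+_ (cong (if_then 0 else 1) (does-⇔ (mk⇔ sym sym) (a ≟ b) (b ≟ a))) (dist-sym u v)

dist≡0⇒≡ : ∀ {n} {u v : Word n} → dist u v ≡ 0 → u ≡ v
dist≡0⇒≡ {u = []}    {[]}    _ = refl
dist≡0⇒≡ {u = a ∷ u} {b ∷ v} d with a ≟ b
... | yes refl = cong (a ∷_) (dist≡0⇒≡ d)

isometry⇒injective : ∀ {m n} {f : Word m → Word n} → Isometry f → ∀ {u v} → f u ≡ f v → u ≡ v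
isometry⇒injective {f = f} iso {u} {v} fu≡fv =
  dist≡0⇒≡ (trans (sym (iso u v)) (trans (cong (dist (f u)) (sym fu≡fv)) (dist-self (f u))))

∷-isometry : ∀ {n} (a : Fin 3) → Isometry {n} (a ∷_)
∷-isometry a u v rewrite dec-true (a ≟ a) refl = refl

Cherry : ∀ {n} → (Word n → Set) → Word n → Word n → Word n → Set
Cherry P c x y = P c × P x × P y × dist x c ≡ 1 × dist y c ≡ 1 × x ≢ y

CherryFree : ∀ n → (Word n → Bool) → Set
CherryFree n Z = ∀ c x y → ¬ Cherry (T ∘ Z) c x y

cherryFree-∘ : ∀ {m n} {f : Word m → Word n} {Z} → Isometry f → CherryFree n Z → CherryFree m (Z ∘ f)
cherryFree-∘ {f = f} iso cf c x y (Zc , Zx , Zy , xc , yc , x≢y) =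
  cf (f c) (f x) (f y) (Zc , Zx , Zy , trans (iso x c) xc , trans (iso y c) yc , x≢y ∘ isometry⇒injective iso)

cherryFree-slice : ∀ {n} {Z : Word (suc n) → Bool} → CherryFree (suc n) Z → ∀ a → CherryFree n (slice Z a)
cherryFree-slice cf a = cherryFree-∘ (∷-isometry a) cf

maxDeg≤1⇒cherryFree : ∀ {X} → (∀ v → X v ≡ true → degIn X v ≤ 1) → CherryFree 4 X
maxDeg≤1⇒cherryFree {X} deg≤1 c x y (Xc , Xx , Xy , xc , yc , x≢y) =
  <⇒≱ (count-pair 4 {λ u → X u ∧ adj? u c} x≢y (neighbour Xx xc) (neighbour Xy yc))
      (subst (_≤ 1) (length-filter≡count 4 (λ u → X u ∧ adj? u c)) (deg≤1 c (Equivalence.to T-≡ Xc)))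
  where
  neighbour : ∀ {u} → T (X u) → dist u c ≡ 1 → T (X u ∧ adj? u c)
  neighbour {u} Xu uc = Equivalence.from T-∧ (Xu , ℕ.≡⇒≡ᵇ (dist u c) 1 uc)

-- Automorphisms of H(n,3)

record Automorphism (n : ℕ) : Set where
  field
    bijection : Word n ↔ Word n
    isometry  : Isometry (Inverse.to bijection)
  open Inverse bijection public using (to; from; strictlyInverseˡ; strictlyInverseʳ)
open Automorphism public

idᵃ : ∀ {n} → Automorphism n
idᵃ = record { bijection = ↔-id _ ; isometry = λ _ _ → refl }

infixr 9 _∘ᵃ_
infixr 5 _∷ᵃ_

_∘ᵃ_ : ∀ {n} → Automorphism n → Automorphism n → Automorphism n
f ∘ᵃ g = record
  { bijection = bijection f ↔-∘ bijection g
  ; isometry  = λ u v → trans (isometry f (to g u) (to g v)) (isometry g u v)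
  }

_∷ᵃ_ : ∀ {n} → Permutation′ 3 → Automorphism n → Automorphism (suc n)
_∷ᵃ_ {n} π g = record { bijection = mk↔ₛ′ to′ from′ to∘from from∘to ; isometry = iso }
  where
  to′ from′ : Word (suc n) → Word (suc n)
  to′   (a ∷ w) = (π ⟨$⟩ʳ a) ∷ to g w
  from′ (a ∷ w) = (π ⟨$⟩ˡ a) ∷ from g w
  to∘from : ∀ w → to′ (from′ w) ≡ w
  to∘from (a ∷ w) = cong₂ _∷_ (Perm.inverseʳ π) (strictlyInverseˡ g w)
  from∘to : ∀ w → from′ (to′ w) ≡ w
  from∘to (a ∷ w) = cong₂ _∷_ (Perm.inverseˡ π) (strictlyInverseʳ g w)
  π-preserves-≡ : ∀ a b → (π ⟨$⟩ʳ a ≡ π ⟨$⟩ʳ b) ⇔ (a ≡ b)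
  π-preserves-≡ a b = mk⇔ (Injection.injective (↔⇒↣ π)) (cong (π ⟨$⟩ʳ_))
  iso : Isometry to′
  iso (a ∷ u) (b ∷ v) =
    cong₂ _+_ (cong (if_then 0 else 1) (does-⇔ (π-preserves-≡ a b) (π ⟨$⟩ʳ a ≟ π ⟨$⟩ʳ b) (a ≟ b)))
              (isometry g u v)

swapᵃ : ∀ {n} → Automorphism (suc (suc n))
swapᵃ {n} = record { bijection = mk↔ₛ′ swap swap involutive involutive ; isometry = iso }
  where
  swap : Word (suc (suc n)) → Word (suc (suc n))
  swap (a ∷ b ∷ w) = b ∷ a ∷ w
  involutive : ∀ w → swap (swap w) ≡ w
  involutive (a ∷ b ∷ w) = refl
  differ : Fin 3 → Fin 3 → ℕ
  differ a b = if does (a ≟ b) then 0 else 1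
  iso : Isometry swap
  iso (a ∷ b ∷ u) (a′ ∷ b′ ∷ v) = x∙yz≈y∙xz (differ b b′) (differ a a′) (dist u v)

toFront : ∀ {n} → Fin n → Automorphism n
toFront                0F      = idᵃ
toFront {suc zero}    (suc ())
toFront {suc (suc n)} (suc i) = swapᵃ ∘ᵃ (Perm.id ∷ᵃ toFront i)

symbolPermutations : List (Permutation′ 3)
symbolPermutations =
  Perm.id ∷ transpose 1F 2F ∷ transpose 0F 1F ∷ transpose 0F 2F ∷
  transpose 0F 1F ∘ₚ transpose 1F 2F ∷ transpose 1F 2F ∘ₚ transpose 0F 1F ∷ []

-- These lists contain every automorphism, but nothing relies on that: a search only uses the
-- automorphisms it finds. The order merely makes the searches fast.
automorphisms : ∀ n → List (Automorphism n)
firstCoordinateFixing : ∀ n → List (Automorphism (suc n))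

automorphisms zero    = idᵃ ∷ []
automorphisms (suc n) = concatMap (λ i → map (_∘ᵃ toFront i) (firstCoordinateFixing n)) (allFin (suc n))

firstCoordinateFixing n = concatMap (λ π → map (π ∷ᵃ_) (automorphisms n)) symbolPermutations

isAutomorphism : (f : Automorphism 4) → IsAutomorphism (to f)
isAutomorphism f =
  (from f , strictlyInverseʳ f , strictlyInverseˡ f) ,
  λ u v → mk⇔ (trans (isometry f u v)) (trans (sym (isometry f u v)))

Equivalent : ∀ n → (Word n → Bool) → (Word n → Bool) → Set
Equivalent n Z S = ∃ λ (h : Automorphism n) → ∀ w → Z (to h w) ≡ S w

equivalent-∘ : ∀ {n} {Z S : Word n → Bool} (g : Automorphism n) → Equivalent n (Z ∘ to g) S → Equivalent n Z S
equivalent-∘ g (h , Zgh≡S) = g ∘ᵃ h , Zgh≡S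

-- Partial sets and the branch-and-bound search

Trie : Set → ℕ → Set
Trie A zero    = A
Trie A (suc n) = Trie A n × Trie A n × Trie A n

infixl 9 _‼_
infixl 6 _[_]≔_

_‼_ : ∀ {A n} → Trie A n → Word n → A
_‼_ {n = zero}  x              []       = x
_‼_ {n = suc n} (t₀ , t₁ , t₂) (0F ∷ w) = t₀ ‼ w
_‼_ {n = suc n} (t₀ , t₁ , t₂) (1F ∷ w) = t₁ ‼ w
_‼_ {n = suc n} (t₀ , t₁ , t₂) (2F ∷ w) = t₂ ‼ w

tabulateᵗ : ∀ {A} n → (Word n → A) → Trie A n
tabulateᵗ zero    f = f []
tabulateᵗ (suc n) f = tabulateᵗ n (slice f 0F) , tabulateᵗ n (slice f 1F) , tabulateᵗ n (slice f 2F)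

‼-tabulate : ∀ {A} n (f : Word n → A) w → tabulateᵗ n f ‼ w ≡ f w
‼-tabulate zero    f []       = refl
‼-tabulate (suc n) f (0F ∷ w) = ‼-tabulate n (slice f 0F) w
‼-tabulate (suc n) f (1F ∷ w) = ‼-tabulate n (slice f 1F) w
‼-tabulate (suc n) f (2F ∷ w) = ‼-tabulate n (slice f 2F) w

_[_]≔_ : ∀ {A n} → Trie A n → Word n → A → Trie A n
_[_]≔_ {n = zero}  _              []       x = x
_[_]≔_ {n = suc n} (t₀ , t₁ , t₂) (0F ∷ v) x = t₀ [ v ]≔ x , t₁ , t₂
_[_]≔_ {n = suc n} (t₀ , t₁ , t₂) (1F ∷ v) x = t₀ , t₁ [ v ]≔ x , t₂
_[_]≔_ {n = suc n} (t₀ , t₁ , t₂) (2F ∷ v) x = t₀ , t₁ , t₂ [ v ]≔ x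

[]≔-preserves : ∀ {A n} (P : Word n → A → Set) (t : Trie A n) v x →
                (∀ w → P w (t ‼ w)) → P v x → ∀ w → P w ((t [ v ]≔ x) ‼ w)
[]≔-preserves P _            []       x _  Px []       = Px
[]≔-preserves P (t₀ , _ , _) (0F ∷ v) x Pt Px (0F ∷ w) = []≔-preserves (slice P 0F) t₀ v x (Pt ∘ (0F ∷_)) Px w
[]≔-preserves P (_ , t₁ , _) (1F ∷ v) x Pt Px (1F ∷ w) = []≔-preserves (slice P 1F) t₁ v x (Pt ∘ (1F ∷_)) Px w
[]≔-preserves P (_ , _ , t₂) (2F ∷ v) x Pt Px (2F ∷ w) = []≔-preserves (slice P 2F) t₂ v x (Pt ∘ (2F ∷_)) Px w
[]≔-preserves P _            (0F ∷ _) _ Pt _  (1F ∷ w) = Pt (1F ∷ w)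
[]≔-preserves P _            (0F ∷ _) _ Pt _  (2F ∷ w) = Pt (2F ∷ w)
[]≔-preserves P _            (1F ∷ _) _ Pt _  (0F ∷ w) = Pt (0F ∷ w)
[]≔-preserves P _            (1F ∷ _) _ Pt _  (2F ∷ w) = Pt (2F ∷ w)
[]≔-preserves P _            (2F ∷ _) _ Pt _  (0F ∷ w) = Pt (0F ∷ w)
[]≔-preserves P _            (2F ∷ _) _ Pt _  (1F ∷ w) = Pt (1F ∷ w)

Partial : ℕ → Set
Partial = Trie (Maybe Bool)

undecided : ∀ n → Partial n
undecided n = tabulateᵗ n (const nothing)

infix 4 _Completes_

_Completes_ : ∀ {n} → (Word n → Bool) → Partial n → Set
Z Completes ρ = ∀ w → All (Z w ≡_) (ρ ‼ w)

completes-undecided : ∀ {n} (Z : Word n → Bool) → Z Completes undecided n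
completes-undecided {n} Z w = subst (All (Z w ≡_)) (sym (‼-tabulate n (const nothing) w)) nothing

completes-[]≔ : ∀ {n} {Z : Word n → Bool} {ρ v x} → Z Completes ρ → All (Z v ≡_) x → Z Completes ρ [ v ]≔ x
completes-[]≔ {Z = Z} {ρ} {v} {x} = []≔-preserves (λ w → All (Z w ≡_)) ρ v x

completes-decided : ∀ {n} {Z : Word n → Bool} {ρ w b} → Z Completes ρ → ρ ‼ w ≡ just b → Z w ≡ b
completes-decided {Z = Z} {w = w} Zρ ρw≡b = drop-just (subst (All (Z w ≡_)) ρw≡b (Zρ w))

cellBound : Maybe Bool → ℕ
cellBound (just false) = 0
cellBound _            = 1

cellBound-sound : ∀ {b x} → All (b ≡_) x → (if b then 1 else 0) ≤ cellBound x
cellBound-sound {false} _           = z≤n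
cellBound-sound {true}  nothing     = ≤-refl
cellBound-sound {true}  (just refl) = ≤-refl

sizeBound : ℕ → ℕ
sizeBound 1 = 2
sizeBound 2 = 4
sizeBound 3 = 10
sizeBound n = 3 ^ n

SizeBounded : ℕ → Set
SizeBounded n = ∀ Z → CherryFree n Z → count n Z ≤ sizeBound n

SizeBoundedUpTo : ℕ → Set
SizeBoundedUpTo zero    = ⊤
SizeBoundedUpTo (suc n) = SizeBoundedUpTo n × SizeBounded (suc n)

bound : ∀ n → Partial n → ℕ
sliceBound : ∀ n → Partial (suc n) → ℕ

bound zero    x = cellBound x
bound (suc n) ρ = sizeBound (suc n) ⊓ sliceBound n ρ

sliceBound n (ρ₀ , ρ₁ , ρ₂) = bound n ρ₀ + (bound n ρ₁ + bound n ρ₂)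

bound-sound : ∀ n → SizeBoundedUpTo n → ∀ {Z ρ} → CherryFree n Z → Z Completes ρ → count n Z ≤ bound n ρ
sliceBound-sound : ∀ n → SizeBoundedUpTo n → ∀ {Z ρ} → CherryFree (suc n) Z → Z Completes ρ →
                   count (suc n) Z ≤ sliceBound n ρ

bound-sound zero    _             _  Zρ = cellBound-sound (Zρ [])
bound-sound (suc n) (bounded , b) cf Zρ = ⊓-glb (b _ cf) (sliceBound-sound n bounded cf Zρ)

sliceBound-sound n bounded {ρ = ρ₀ , ρ₁ , ρ₂} cf Zρ =
  +-mono-≤ (bound-sound n bounded (cherryFree-slice cf 0F) (Zρ ∘ (0F ∷_)))
           (+-mono-≤ (bound-sound n bounded (cherryFree-slice cf 1F) (Zρ ∘ (1F ∷_)))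
                     (bound-sound n bounded (cherryFree-slice cf 2F) (Zρ ∘ (2F ∷_))))

Included : ∀ {n} → Partial n → Word n → Set
Included ρ w = ρ ‼ w ≡ just true

included? : ∀ {n} (ρ : Partial n) w → Dec (Included ρ w)
included? ρ w = Maybe.≡-dec Bool._≟_ (ρ ‼ w) (just true)

included-sound : ∀ {n} {Z : Word n → Bool} {ρ w} → Z Completes ρ → Included ρ w → T (Z w)
included-sound Zρ ρw = Equivalence.from T-≡ (completes-decided Zρ ρw)

neighbours : ∀ {n} → Word n → List (Word n)
neighbours []      = []
neighbours (a ∷ w) = map (_∷ w) (filter (λ b → ¬? (b ≟ a)) (allFin 3)) ++ map (a ∷_) (neighbours w)

IncludedNeighbour : ∀ {n} → Partial n → Word n → Word n → Set
IncludedNeighbour ρ c x = Included ρ x × dist x c ≡ 1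

includedNeighbour? : ∀ {n} (ρ : Partial n) c x → Dec (IncludedNeighbour ρ c x)
includedNeighbour? ρ c x = included? ρ x ×-dec dist x c ℕ.≟ 1

OtherIncludedNeighbour : ∀ {n} → Partial n → Word n → Word n → Set
OtherIncludedNeighbour ρ c x = Any (λ y → IncludedNeighbour ρ c y × x ≢ y) (neighbours c)

otherIncludedNeighbour? : ∀ {n} (ρ : Partial n) c x → Dec (OtherIncludedNeighbour ρ c x)
otherIncludedNeighbour? ρ c x = any? (λ y → includedNeighbour? ρ c y ×-dec ¬? (x ≟ʷ y)) (neighbours c)

-- Once v is included, a new cherry has centre v or centre an included neighbour t of v. The
-- distances are checked again, so soundness does not depend on the list of neighbours.
CherryThrough : ∀ {n} → Partial n → Word n → Set
CherryThrough ρ v =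
  Included ρ v ×
  Any (λ t → IncludedNeighbour ρ v t × (OtherIncludedNeighbour ρ v t ⊎ OtherIncludedNeighbour ρ t v)) (neighbours v)

cherryThrough? : ∀ {n} (ρ : Partial n) v → Dec (CherryThrough ρ v)
cherryThrough? ρ v =
  included? ρ v ×-dec
  any? (λ t → includedNeighbour? ρ v t ×-dec (otherIncludedNeighbour? ρ v t ⊎-dec otherIncludedNeighbour? ρ t v))
       (neighbours v)

cherryThrough-sound : ∀ {n} {Z : Word n → Bool} {ρ v} → CherryThrough ρ v → Z Completes ρ → ¬ CherryFree n Z
cherryThrough-sound {v = v} (ρv , through) Zρ cf with satisfied through
... | t , (ρt , tv) , inj₁ other =
  let y , (ρy , yv) , t≢y = satisfied other
  in cf v t y (included-sound Zρ ρv , included-sound Zρ ρt , included-sound Zρ ρy , tv , yv , t≢y)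
... | t , (ρt , tv) , inj₂ other =
  let y , (ρy , yt) , v≢y = satisfied other
  in cf t v y (included-sound Zρ ρt , included-sound Zρ ρv , included-sound Zρ ρy ,
               trans (dist-sym v t) tv , yt , v≢y)

module Search {m : ℕ} (K : ℕ) (leaf : Partial (suc m) → Bool) where

  hopeless : Partial (suc m) → Bool
  hopeless ρ = sliceBound m ρ <ᵇ K

  search : List (Word (suc m)) → Partial (suc m) → Bool
  search []       ρ = hopeless ρ ∨ leaf ρ
  search (v ∷ vs) ρ =
    hopeless ρ ∨ ((isYes (cherryThrough? (ρ [ v ]≔ just true) v) ∨ search vs (ρ [ v ]≔ just true))
                  ∧ search vs (ρ [ v ]≔ just false))

  module Sound (Q : (Word (suc m) → Bool) → Set)
               (leaf-sound : ∀ {Z ρ} → T (leaf ρ) → Z Completes ρ → Q Z)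
               (bounded : SizeBoundedUpTo m) where

    not-hopeless : ∀ {Z ρ} → T (hopeless ρ) → CherryFree (suc m) Z → Z Completes ρ → ¬ K ≤ count (suc m) Z
    not-hopeless small cf Zρ large = <⇒≱ (<ᵇ⇒< _ _ small) (≤-trans large (sliceBound-sound m bounded cf Zρ))

    search-sound : ∀ vs {ρ Z} → T (search vs ρ) → CherryFree (suc m) Z → Z Completes ρ →
                   K ≤ count (suc m) Z → Q Z
    search-sound [] ok cf Zρ large with Equivalence.to T-∨ ok
    ... | inj₁ small  = ⊥-elim (not-hopeless small cf Zρ large)
    ... | inj₂ leafOk = leaf-sound leafOk Zρ
    search-sound (v ∷ vs) {Z = Z} ok cf Zρ large with Equivalence.to T-∨ ok
    ... | inj₁ small    = ⊥-elim (not-hopeless small cf Zρ large)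
    ... | inj₂ branches with Equivalence.to T-∧ branches | Z v in Zv
    ...   | included , _ | true with Equivalence.to T-∨ included
    ...     | inj₁ cherry = ⊥-elim (cherryThrough-sound (toWitness cherry) (completes-[]≔ Zρ (just Zv)) cf)
    ...     | inj₂ ok′    = search-sound vs ok′ cf (completes-[]≔ Zρ (just Zv)) large
    search-sound (v ∷ vs) {Z = Z} ok cf Zρ large | inj₂ _ | _ , excluded | false =
      search-sound vs excluded cf (completes-[]≔ Zρ (just Zv)) large

-- Classification by slices

Classifies : ∀ n → ℕ → List (Word n → Bool) → Set
Classifies n k Rs = ∀ Z → CherryFree n Z → k ≤ count n Z → Any (Equivalent n Z) Rs

laterSlices : ∀ n → List (Word (suc n))
laterSlices n = map (1F ∷_) (allWords n) ++ map (2F ∷_) (allWords n)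

withFirstSlice : ∀ {n} → (Word n → Bool) → Partial (suc n)
withFirstSlice {n} R = tabulateᵗ n (just ∘ R) , undecided n , undecided n

completes-withFirstSlice : ∀ {n} {Z : Word (suc n) → Bool} {R} →
                           (∀ w → Z (0F ∷ w) ≡ R w) → Z Completes withFirstSlice R
completes-withFirstSlice {n} {R = R} Z₀≡R (0F ∷ w) =
  subst (All _) (sym (‼-tabulate n (just ∘ R) w)) (just (Z₀≡R w))
completes-withFirstSlice {Z = Z}      _     (1F ∷ w) = completes-undecided (slice Z 1F) w
completes-withFirstSlice {Z = Z}      _     (2F ∷ w) = completes-undecided (slice Z 2F) w

equivalentToSome : ∀ {n} → List (Word n → Bool) → Partial n → Bool
equivalentToSome {n} Ss ρ =
  isYes (any? (λ S → any? (λ h → ∀ʷ? λ w → Maybe.≡-dec Bool._≟_ (ρ ‼ to h w) (just (S w)))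
                             (automorphisms n))
              Ss)

equivalentToSome-sound : ∀ {n} {Ss ρ} {Z : Word n → Bool} →
                         T (equivalentToSome Ss ρ) → Z Completes ρ → Any (Equivalent n Z) Ss
equivalentToSome-sound ok Zρ =
  Any.map (λ matched → let h , matches = satisfied matched in h , λ w → completes-decided Zρ (matches w))
          (toWitness ok)

heavySlice : ∀ n (Z : Word (suc n) → Bool) j → j + (j + j) < count (suc n) Z → ∃ λ a → j < count n (slice Z a)
heavySlice n Z j large with j <? count n (slice Z 0F) | j <? count n (slice Z 1F) | j <? count n (slice Z 2F)
... | yes heavy | _         | _         = 0F , heavy
... | no _      | yes heavy | _         = 1F , heavy
... | no _      | no _      | yes heavy = 2F , heavy
... | no light₀ | no light₁ | no light₂ =
  ⊥-elim (<⇒≱ large (+-mono-≤ (≮⇒≥ light₀) (+-mono-≤ (≮⇒≥ light₁) (≮⇒≥ light₂))))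

classifies-step : ∀ {n j K} {Rs : List (Word n → Bool)} {Ss} → SizeBoundedUpTo n → j + (j + j) < K →
  Classifies n (suc j) Rs →
  All.All (λ R → T (Search.search K (equivalentToSome Ss) (laterSlices n) (withFirstSlice R))) Rs →
  Classifies (suc n) K Ss
classifies-step {n} {j} {K} {Ss = Ss} bounded 3j<K classifies searched Z cf large =
  let a , heavy        = heavySlice n Z j (<-≤-trans 3j<K large)
      ok , (h , front) = All.lookupAny searched (classifies (slice Z a) (cherryFree-slice cf a) heavy)
      G                = transpose 0F a ∷ᵃ h
  in Any.map (equivalent-∘ {Z = Z} G)
       (Search.Sound.search-sound K (equivalentToSome Ss) (λ Z → Any (Equivalent (suc n) Z) Ss) equivalentToSome-sound
          bounded (laterSlices n) ok (cherryFree-∘ {f = to G} (isometry G) cf) (completes-withFirstSlice front)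
          (subst (K ≤_) (sym (count-↔ (suc n) (bijection G) Z)) large))

classifies-[]⇒sizeBounded : ∀ {n} → Classifies n (suc (sizeBound n)) [] → SizeBounded n
classifies-[]⇒sizeBounded none Z cf = ≮⇒≥ λ large → ¬Any[] (none Z cf large)

classifies₀ : Classifies 0 1 (const true ∷ [])
classifies₀ Z _ one with Z [] in Z[]
... | true = here (idᵃ , λ { [] → Z[] })
... | false with () ← one

-- The representatives are the first completions reached by the searches that classify them.

extremal₁ : Word 1 → Bool
extremal₁ (0F ∷ []) = true
extremal₁ (1F ∷ []) = true
extremal₁ _ = false

sizeBounded₁ : SizeBounded 1
sizeBounded₁ = classifies-[]⇒sizeBounded (classifies-step tt (<ᵇ⇒< _ _ tt) classifies₀ (tt ∷ []))

classifies₁ : Classifies 1 2 (extremal₁ ∷ [])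
classifies₁ = classifies-step tt (<ᵇ⇒< _ _ tt) classifies₀ (tt ∷ [])

sizeBoundedUpTo₁ : SizeBoundedUpTo 1
sizeBoundedUpTo₁ = tt , sizeBounded₁

extremal₂ : Word 2 → Bool
extremal₂ (0F ∷ 0F ∷ []) = true
extremal₂ (0F ∷ 1F ∷ []) = true
extremal₂ (1F ∷ 2F ∷ []) = true
extremal₂ (2F ∷ 2F ∷ []) = true
extremal₂ _ = false

sizeBounded₂ : SizeBounded 2
sizeBounded₂ = classifies-[]⇒sizeBounded (classifies-step sizeBoundedUpTo₁ (<ᵇ⇒< _ _ tt) classifies₁ (tt ∷ []))

classifies₂ : Classifies 2 4 (extremal₂ ∷ [])
classifies₂ = classifies-step sizeBoundedUpTo₁ (<ᵇ⇒< _ _ tt) classifies₁ (tt ∷ [])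

sizeBoundedUpTo₂ : SizeBoundedUpTo 2
sizeBoundedUpTo₂ = sizeBoundedUpTo₁ , sizeBounded₂

extremal₃ extremal₃′ : Word 3 → Bool
extremal₃ (0F ∷ 0F ∷ 0F ∷ []) = true
extremal₃ (0F ∷ 0F ∷ 1F ∷ []) = true
extremal₃ (0F ∷ 1F ∷ 2F ∷ []) = true
extremal₃ (0F ∷ 2F ∷ 2F ∷ []) = true
extremal₃ (1F ∷ 0F ∷ 2F ∷ []) = true
extremal₃ (1F ∷ 1F ∷ 0F ∷ []) = true
extremal₃ (1F ∷ 1F ∷ 1F ∷ []) = true
extremal₃ (2F ∷ 0F ∷ 2F ∷ []) = true
extremal₃ (2F ∷ 2F ∷ 0F ∷ []) = true
extremal₃ (2F ∷ 2F ∷ 1F ∷ []) = true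
extremal₃ _ = false
extremal₃′ (0F ∷ 0F ∷ 0F ∷ []) = true
extremal₃′ (0F ∷ 0F ∷ 1F ∷ []) = true
extremal₃′ (0F ∷ 1F ∷ 2F ∷ []) = true
extremal₃′ (0F ∷ 2F ∷ 2F ∷ []) = true
extremal₃′ (1F ∷ 0F ∷ 2F ∷ []) = true
extremal₃′ (1F ∷ 1F ∷ 0F ∷ []) = true
extremal₃′ (1F ∷ 2F ∷ 1F ∷ []) = true
extremal₃′ (2F ∷ 0F ∷ 2F ∷ []) = true
extremal₃′ (2F ∷ 1F ∷ 1F ∷ []) = true
extremal₃′ (2F ∷ 2F ∷ 0F ∷ []) = true
extremal₃′ _ = false

sizeBounded₃ : SizeBounded 3
sizeBounded₃ = classifies-[]⇒sizeBounded (classifies-step sizeBoundedUpTo₂ (<ᵇ⇒< _ _ tt) classifies₂ (tt ∷ []))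

classifies₃ : Classifies 3 10 (extremal₃ ∷ extremal₃′ ∷ [])
classifies₃ = classifies-step sizeBoundedUpTo₂ (<ᵇ⇒< _ _ tt) classifies₂ (tt ∷ [])

extremal₄ : Word 4 → Bool
extremal₄ (0F ∷ 0F ∷ 0F ∷ 0F ∷ []) = true
extremal₄ (0F ∷ 0F ∷ 0F ∷ 1F ∷ []) = true
extremal₄ (0F ∷ 0F ∷ 1F ∷ 2F ∷ []) = true
extremal₄ (0F ∷ 0F ∷ 2F ∷ 2F ∷ []) = true
extremal₄ (0F ∷ 1F ∷ 0F ∷ 2F ∷ []) = true
extremal₄ (0F ∷ 1F ∷ 1F ∷ 0F ∷ []) = true
extremal₄ (0F ∷ 1F ∷ 2F ∷ 1F ∷ []) = true
extremal₄ (0F ∷ 2F ∷ 0F ∷ 2F ∷ []) = true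
extremal₄ (0F ∷ 2F ∷ 1F ∷ 1F ∷ []) = true
extremal₄ (0F ∷ 2F ∷ 2F ∷ 0F ∷ []) = true
extremal₄ (1F ∷ 0F ∷ 0F ∷ 2F ∷ []) = true
extremal₄ (1F ∷ 0F ∷ 1F ∷ 0F ∷ []) = true
extremal₄ (1F ∷ 0F ∷ 2F ∷ 1F ∷ []) = true
extremal₄ (1F ∷ 1F ∷ 0F ∷ 0F ∷ []) = true
extremal₄ (1F ∷ 1F ∷ 1F ∷ 1F ∷ []) = true
extremal₄ (1F ∷ 1F ∷ 1F ∷ 2F ∷ []) = true
extremal₄ (1F ∷ 1F ∷ 2F ∷ 0F ∷ []) = true
extremal₄ (1F ∷ 2F ∷ 0F ∷ 1F ∷ []) = true
extremal₄ (1F ∷ 2F ∷ 1F ∷ 0F ∷ []) = true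
extremal₄ (1F ∷ 2F ∷ 2F ∷ 2F ∷ []) = true
extremal₄ (2F ∷ 0F ∷ 0F ∷ 2F ∷ []) = true
extremal₄ (2F ∷ 0F ∷ 1F ∷ 1F ∷ []) = true
extremal₄ (2F ∷ 0F ∷ 2F ∷ 0F ∷ []) = true
extremal₄ (2F ∷ 1F ∷ 0F ∷ 1F ∷ []) = true
extremal₄ (2F ∷ 1F ∷ 1F ∷ 0F ∷ []) = true
extremal₄ (2F ∷ 1F ∷ 2F ∷ 2F ∷ []) = true
extremal₄ (2F ∷ 2F ∷ 0F ∷ 0F ∷ []) = true
extremal₄ (2F ∷ 2F ∷ 1F ∷ 2F ∷ []) = true
extremal₄ (2F ∷ 2F ∷ 2F ∷ 1F ∷ []) = true
extremal₄ _ = false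

classifies₄ : Classifies 4 29 (extremal₄ ∷ [])
classifies₄ = classifies-step (sizeBoundedUpTo₂ , sizeBounded₃) (<ᵇ⇒< _ _ tt) classifies₃ (tt ∷ tt ∷ [])

X : SubsetV
X = extremal₄

X-good : Good X
X-good = (maxDeg≤1 , (0F ∷ 0F ∷ 0F ∷ 0F ∷ []) , refl , refl) , refl
  where
  maxDeg≤1 : ∀ v → X v ≡ true → degIn X v ≤ 1
  maxDeg≤1 = toWitness {a? = ∀ʷ? λ v → (X v Bool.≟ true) →-dec (degIn X v ℕ.≤? 1)} tt

equivalent⇒isomorphic : ∀ {X Y} → Equivalent 4 Y X → Isomorphic X Y
equivalent⇒isomorphic (f , Yf≡X) = to f , isAutomorphism f , Yf≡X

theoremA1 : Σ SubsetV λ X → Good X × ((Y : SubsetV) → Good Y → Isomorphic X Y)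
theoremA1 = X , X-good , λ Y ((maxDeg≤1 , _) , |Y|≡29) →
  equivalent⇒isomorphic {Y = Y}
    (singleton⁻ (classifies₄ Y (maxDeg≤1⇒cherryFree maxDeg≤1)
                              (≤-reflexive (trans (sym |Y|≡29) (length-filter≡count 4 Y)))))
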